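{- Let $n\ge 1$ and $k>n$ be integers and let $y\in[k]^n$ have pairwise distinct entries. Let $\overline{\sigma}^1$ be the identity permutation of $[k]$, written as the vector $(1,2,\dots,k)$, and for $j\in[k-1]$ let $\overline{\sigma}^{j+1}$ be obtained from $\overline{\sigma}^{j}$ by a circular shift to the right (i.e. $\overline{\sigma}^{j+1}=(\overline{\sigma}^j_k,\overline{\sigma}^j_1,\dots,\overline{\sigma}^j_{k-1})$). For $j\in[k]$ let $\sigma^j=(\overline{\sigma}^j_1,\dots,\overline{\sigma}^j_n)$ be the restriction to the first $n$ positions. Then there is a $j\in[k]$ with $\mathrm{black}(\sigma^j,y)=0$.
   Context: For $x,y\in[k]^n$, $\mathrm{black}(x,y)=|\{i\in[n]: x_i=y_i\}|$, where $[m]=\{1,\dots,m\}$. -}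

module Defs where

open import Data.Nat using (ℕ; zero; suc; _≤_; _<_)
open import Data.Fin using (Fin; zero; suc; fromℕ; inject₁; inject≤; toℕ)
open import Data.Fin.Properties using (_≟_)
open import Data.List using (List; length; filter; allFin)
open import Function using (_∘_)
open import Relation.Nullary.Decidable using (Dec)

-- Vectors in [k]^n are represented as functions Fin n → Fin k
-- (entries and positions are 0-indexed: value/position t stands for t+1).

black : ∀ {n k} → (Fin n → Fin k) → (Fin n → Fin k) → ℕ
black {n} x y = length (filter (λ i → x i ≟ y i) (allFin n))

shiftR : ∀ {m} {A : Set} → (Fin (suc m) → A) → (Fin (suc m) → A)
shiftR {m} v zero    = v (fromℕ m)
shiftR {m} v (suc i) = v (inject₁ i)

iterate : ∀ {A : Set} → (A → A) → ℕ → A → A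
iterate f zero    a = a
iterate f (suc t) a = f (iterate f t a)

-- σ̄^{j+1} (0-indexed j : Fin k): identity shifted right j times
σbar : ∀ {m} → Fin (suc m) → (Fin (suc m) → Fin (suc m))
σbar j = iterate shiftR (toℕ j) (λ i → i)

σ : ∀ {n m} → n ≤ suc m → Fin (suc m) → (Fin n → Fin (suc m))
σ n≤k j i = σbar j (inject≤ i n≤k)

-- The value of the j-th shift at a fixed position p is p − j cyclically, so
-- distinct shifts differ at every position and each position i can agree with
-- y_i for at most one shift. With only n positions and k > n shifts, some shift
-- agrees with y nowhere. Neither n ≥ 1 nor distinctness of the entries of y
-- is needed.
module Submission where

open import Defs
open import Data.Nat using (ℕ; suc; zero; _≤_; _<_; _+_)
open import Data.Nat.Properties
  using (<⇒≤; +-suc; +-comm; +-identityʳ; +-cancelˡ-≡; ≤-trans; n≤1+n; n<1+n; <-irrefl;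
         <-asym; m≤m+n; m≤n+m; +-monoʳ-≤; +-monoˡ-≤; +-monoʳ-<; module ≤-Reasoning)
open import Data.Fin using (Fin; zero; suc; fromℕ; inject₁; toℕ; inject≤)
open import Data.Fin.Properties
  using (toℕ-inject₁; toℕ-fromℕ; toℕ-injective; toℕ≤pred[n]; any?; all?; ¬∀⟶∃¬;
         pigeonhole; <⇒≢; _≟_)
open import Data.Product using (∃; _,_; proj₁; proj₂)
open import Data.Sum using (_⊎_; inj₁; inj₂)
open import Data.Empty using (⊥; ⊥-elim)
open import Data.List using (length; filter; allFin)
open import Data.List.Properties using (filter-none)
import Data.List.Relation.Unary.All as All
open import Relation.Nullary using (¬_; Dec; yes; no; contradiction)
open import Relation.Binary.PropositionalEquality using (_≡_; _≢_; refl; sym; trans; cong; subst; module ≡-Reasoning)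
open import Function.Definitions using (Injective)

iterate-comm : ∀ {A : Set} (f : A → A) t x → iterate f t (f x) ≡ f (iterate f t x)
iterate-comm f zero    x = refl
iterate-comm f (suc t) x = cong f (iterate-comm f t x)

predᶜ : ∀ {m} → Fin (suc m) → Fin (suc m)
predᶜ {m} zero    = fromℕ m
predᶜ     (suc i) = inject₁ i

shiftR-predᶜ : ∀ {m} {A : Set} (v : Fin (suc m) → A) p → shiftR v p ≡ v (predᶜ p)
shiftR-predᶜ v zero    = refl
shiftR-predᶜ v (suc i) = refl

iterate-shiftR : ∀ {m} {A : Set} t (v : Fin (suc m) → A) p →
                 iterate shiftR t v p ≡ v (iterate predᶜ t p)
iterate-shiftR zero    v p = refl
iterate-shiftR (suc t) v p = trans (shiftR-predᶜ (iterate shiftR t v) p)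
  (trans (iterate-shiftR t v (predᶜ p)) (cong v (iterate-comm predᶜ t p)))

σbar-iterate-predᶜ : ∀ {m} (j p : Fin (suc m)) → σbar j p ≡ iterate predᶜ (toℕ j) p
σbar-iterate-predᶜ j = iterate-shiftR (toℕ j) (λ i → i)

-- x lies t steps cyclically before p in Fin (suc m)
Behind : ∀ {m} → ℕ → Fin (suc m) → Fin (suc m) → Set
Behind {m} t p x = toℕ x + t ≡ toℕ p ⊎ toℕ x + t ≡ toℕ p + suc m

behind-predᶜ : ∀ {m} t (p x : Fin (suc m)) → suc t ≤ m → Behind t p x →
               Behind (suc t) p (predᶜ x)
behind-predᶜ {m} t p zero _ (inj₁ t≡p) = inj₂ (begin
  toℕ (fromℕ m) + suc t ≡⟨ cong (_+ suc t) (toℕ-fromℕ m) ⟩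
  m + suc t             ≡⟨ +-comm m (suc t) ⟩
  suc (t + m)           ≡⟨ sym (+-suc t m) ⟩
  t + suc m             ≡⟨ cong (_+ suc m) t≡p ⟩
  toℕ p + suc m         ∎)
  where open ≡-Reasoning
behind-predᶜ {m} t p zero t<m (inj₂ t≡p+k) =
  ⊥-elim (<-asym t<m (subst (m <_) (sym t≡p+k) (m≤n+m (suc m) (toℕ p))))
behind-predᶜ t p (suc i) _ (inj₁ e) = inj₁ (trans (cong (_+ suc t) (toℕ-inject₁ i)) (trans (+-suc (toℕ i) t) e))
behind-predᶜ t p (suc i) _ (inj₂ e) = inj₂ (trans (cong (_+ suc t) (toℕ-inject₁ i)) (trans (+-suc (toℕ i) t) e))

behind-iterate-predᶜ : ∀ {m} t (p : Fin (suc m)) → t ≤ m → Behind t p (iterate predᶜ t p)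
behind-iterate-predᶜ zero    p _     = inj₁ (+-identityʳ (toℕ p))
behind-iterate-predᶜ (suc t) p 1+t≤m =
  behind-predᶜ t p _ 1+t≤m (behind-iterate-predᶜ t p (≤-trans (n≤1+n t) 1+t≤m))

behind-unique : ∀ {m} {a b} {p x : Fin (suc m)} → a ≤ m → b ≤ m →
                Behind a p x → Behind b p x → a ≡ b
behind-unique {x = x} _ _ (inj₁ e₁) (inj₁ e₂) = +-cancelˡ-≡ (toℕ x) _ _ (trans e₁ (sym e₂))
behind-unique {x = x} _ _ (inj₂ e₁) (inj₂ e₂) = +-cancelˡ-≡ (toℕ x) _ _ (trans e₁ (sym e₂))
behind-unique _ b≤m (inj₁ e₁) (inj₂ e₂) = ⊥-elim (behind-both b≤m e₁ e₂)
  where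
  behind-both : ∀ {m a b x p} → b ≤ m → x + a ≡ p → x + b ≡ p + suc m → ⊥
  behind-both {m} {a} {b} {x} {p} b≤m e₁ e₂ = <-irrefl refl (begin-strict
    p + suc m ≡⟨ sym e₂ ⟩
    x + b     ≤⟨ +-monoʳ-≤ x b≤m ⟩
    x + m     ≤⟨ +-monoˡ-≤ m (m≤m+n x a) ⟩
    x + a + m ≡⟨ cong (_+ m) e₁ ⟩
    p + m     <⟨ +-monoʳ-< p (n<1+n m) ⟩
    p + suc m ∎)
    where open ≤-Reasoning
behind-unique a≤m b≤m (inj₂ e₂) (inj₁ e₁) = sym (behind-unique b≤m a≤m (inj₁ e₁) (inj₂ e₂))

σbar-injective-at : ∀ {m} (p : Fin (suc m)) {i j : Fin (suc m)} → σbar i p ≡ σbar j p → i ≡ j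
σbar-injective-at p {i} {j} eq = toℕ-injective
  (behind-unique (toℕ≤pred[n] i) (toℕ≤pred[n] j) (behind i) (subst (Behind (toℕ j) p) (sym eq) (behind j)))
  where
  behind : ∀ j → Behind (toℕ j) p (σbar j p)
  behind j = subst (Behind (toℕ j) p) (sym (σbar-iterate-predᶜ j p))
                   (behind-iterate-predᶜ (toℕ j) p (toℕ≤pred[n] j))

avoid-pigeonhole : ∀ {n k} {R : Fin k → Fin n → Set} → (∀ j i → Dec (R j i)) → n < k →
                   (∀ {i j₁ j₂} → R j₁ i → R j₂ i → j₁ ≡ j₂) →
                   ∃ λ j → ∀ i → ¬ R j i
avoid-pigeonhole {R = R} R? n<k unique with all? (λ j → any? (R? j))
... | no ¬hit =
  let j , ¬any = ¬∀⟶∃¬ _ _ (λ j → any? (R? j)) ¬hit in j , λ i r → ¬any (i , r)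
... | yes hit =
  let j₁ , j₂ , j₁<j₂ , same = pigeonhole n<k (λ j → proj₁ (hit j))
  in contradiction (unique (proj₂ (hit j₁)) (subst (R j₂) (sym same) (proj₂ (hit j₂)))) (<⇒≢ j₁<j₂)

black≡0 : ∀ {n k} {x y : Fin n → Fin k} → (∀ i → x i ≢ y i) → black x y ≡ 0
black≡0 {n} {x = x} {y} x≢y =
  cong length (filter-none (λ i → x i ≟ y i) {xs = allFin n} (All.tabulate (λ {i} _ → x≢y i)))

lemma1 : (n m : ℕ) → 1 ≤ n → (n<k : n < suc m) → (y : Fin n → Fin (suc m))
         → Injective _≡_ _≡_ y
         → ∃ λ (j : Fin (suc m)) → black (σ (<⇒≤ n<k) j) y ≡ 0
lemma1 n m _ n<k y _ =
  let j , misses = avoid-pigeonhole (λ j i → σ n≤k j i ≟ y i) n<k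
                     (λ {i} r₁ r₂ → σbar-injective-at (inject≤ i n≤k) (trans r₁ (sym r₂)))
  in j , black≡0 misses
  where
  n≤k : n ≤ suc m
  n≤k = <⇒≤ n<k
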